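{- Let $(e_0,S_0)$ be a set foundation and let $((x)_X,(t)_T)$ be a dense total order over $(e_0,S_0)$ such that $(x)_X$ has at least two distinct elements. Then there exists a subset $(d)_D$ of $(x)_X$ over $(e_0,S_0)$ which has no least upper bound over $((x)_X,(t)_T)$.
   Context: Base theory: a two-sorted first-order theory with equality whose sorts are words (lower-case variables) and systems (upper-case variables), with two word constants $0$ and $1$, a binary concatenation operation on words written by juxtaposition, and a membership relation $x\in S$ between a word and a system. Axioms: (symbols) $0\neq 1$ and $xy\neq 0$, $xy\neq 1$ for all words $x,y$; (associativity) $(xy)z=x(yz)$; (reading) $x0\neq y1$ for all $x,y$; (simplification) if $x_1y_1=x_2y_2$ and $y_1=y_2$ then $x_1=x_2$; (extensionality) two systems with the same elements are equal; (word induction) every system containing $0$ and $1$ and containing $x0$ and $x1$ whenever it contains $x$ contains every word; (comprehension) for every formula $\phi(x,x_1,\dots,x_n,S_1,\dots,S_m)$ in which $S$ is not free, there is a system $S$ with $x\in S\Leftrightarrow\phi$ for all words $x$. Sets. A system $A$ is an alphabet if for all words $x,y$ and all $z_1,z_2\in A$, $xz_1=yz_2$ implies $z_1=z_2$ and $z_1x=z_2y$ implies $z_1=z_2$. Words over $A$ are the elements of the smallest system containing every element of $A$ and containing $x_2x_1$ whenever $x_1\in A$ and $x_2$ belongs to it. Alphabets $A_1,A_2$ are independent if $A_1\cup A_2$ is an alphabet and $A_1\cap A_2=\emptyset$; a word $e$ and an alphabet $A$ are independent if the one-element system $\{e\}$ and $A$ are independent. A nonempty alphabet $A$ is expressive if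 there exist independent alphabets consisting of words over $A$. A set foundation is a pair $(e_0,S_0)$ with $S_0$ an expressive alphabet and $e_0$ a word independent of $S_0$. A set over $(e_0,S_0)$ is a pair $(e)_S$ of a system $S$ and a word $e$ over $S_0$; $x$ is an element of $(e)_S$ iff $xe_0e\in S$. For an element $x$ of a set with context system $S$, $(x)_S$ denotes the set with representation $x$ and context system $S$. $(b)_B\subseteq(a)_A$ means every element of $(b)_B$ is an element of $(a)_A$. A set $(e)_E$ associates $x_1$ to $x_2$, written $(e)_E=(x_1,x_2)$, if its elements are exactly $x_1$ and $x_1x_2$; $(x_1,x_2)\in(s)_S$ means some element $y$ of $(s)_S$ satisfies $(y)_S=(x_1,x_2)$. $((a)_A,(b)_B,(c)_C)$ is a relation if each element $c_1$ of $(c)_C$ satisfies $(c_1)_C=(a_1,b_1)$ for some elements $a_1$ of $(a)_A$, $b_1$ of $(b)_B$, and no two distinct elements of $(c)_C$ both equal the same $(a_1,b_1)$. Orders. $((a)_A,(r)_R)$ is a partial order if $((a)_A,(a)_A,(r)_R)$ is a relation and for all elements $a_1,a_2,a_3$ of $(a)_A$: $(a_1,a_1)\in(r)_R$; if $(a_1,a_2)\in(r)_R$ and $(a_2,a_1)\in(r)_R$ then $a_1=a_2$; if $(a_1,a_2),(a_2,a_3)\in(r)_R$ then $(a_1,a_3)\in(r)_R$. Write $a_1\le a_2$ iff $(a_1,a_2)\in(r)_R$, and $a_1<a_2$ iff $a_1\le a_2$ and $a_1\neq a_2$. It is total if any two elements are comparable, and dense if whenever $a_1<a_2$ there is an element $a_3$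 with $a_1<a_3<a_2$. For a total order and a subset $(b)_B$ of $(a)_A$, an element $x$ of $(a)_A$ is an upper bound of $(b)_B$ if $x\ge b_1$ for every element $b_1$ of $(b)_B$, and a least upper bound if moreover $x\le x_1$ for every upper bound $x_1$ of $(b)_B$. -}

module Defs where

open import Level using (0ℓ)
open import Data.Nat using (ℕ; suc)
open import Data.Fin using (Fin; zero)
open import Data.Empty using (⊥)
open import Data.Product using (Σ; _×_; _,_; ∃; ∃-syntax)
open import Data.Sum using (_⊎_)
open import Relation.Nullary using (¬_)
open import Relation.Binary.PropositionalEquality using (_≡_; _≢_)
open import Function.Bundles using (_⇔_)
open import Axiom.ExcludedMiddle using (ExcludedMiddle)

-- Syntax of the two-sorted first-order language (de Bruijn indices):
-- n word variables, m system variables.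

data Term (n : ℕ) : Set where
  var  : Fin n → Term n
  c0   : Term n
  c1   : Term n
  _⊙_  : Term n → Term n → Term n

data Formula (n m : ℕ) : Set where
  eqW   : Term n → Term n → Formula n m
  eqS   : Fin m → Fin m → Formula n m
  memb  : Term n → Fin m → Formula n m
  falsum : Formula n m
  _⇒f_  : Formula n m → Formula n m → Formula n m
  _∧f_  : Formula n m → Formula n m → Formula n m
  _∨f_  : Formula n m → Formula n m → Formula n m
  allW  : Formula (suc n) m → Formula n m
  exW   : Formula (suc n) m → Formula n m
  allS  : Formula n (suc m) → Formula n m
  exS   : Formula n (suc m) → Formula n m

record Signature : Set₁ where
  field
    Word   : Set
    System : Set
    𝟎 𝟏    : Word
    _·_    : Word → Word → Word
    _∈_    : Word → System → Set

module Semantics (Σg : Signature) where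
  open Signature Σg

  extend : {A : Set} {n : ℕ} → A → (Fin n → A) → Fin (suc n) → A
  extend a ρ zero = a
  extend a ρ (Fin.suc i) = ρ i

  evalT : {n : ℕ} → (Fin n → Word) → Term n → Word
  evalT ρ (var i) = ρ i
  evalT ρ c0 = 𝟎
  evalT ρ c1 = 𝟏
  evalT ρ (s ⊙ t) = evalT ρ s · evalT ρ t

  sat : {n m : ℕ} → (Fin n → Word) → (Fin m → System) → Formula n m → Set
  sat ρ σ (eqW s t) = evalT ρ s ≡ evalT ρ t
  sat ρ σ (eqS i j) = σ i ≡ σ j
  sat ρ σ (memb t i) = evalT ρ t ∈ σ i
  sat ρ σ falsum = ⊥
  sat ρ σ (φ ⇒f ψ) = sat ρ σ φ → sat ρ σ ψ
  sat ρ σ (φ ∧f ψ) = sat ρ σ φ × sat ρ σ ψ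
  sat ρ σ (φ ∨f ψ) = sat ρ σ φ ⊎ sat ρ σ ψ
  sat ρ σ (allW φ) = (w : Word) → sat (extend w ρ) σ φ
  sat ρ σ (exW φ) = Σ Word λ w → sat (extend w ρ) σ φ
  sat ρ σ (allS φ) = (S : System) → sat ρ (extend S σ) φ
  sat ρ σ (exS φ) = Σ System λ S → sat ρ (extend S σ) φ

record Model : Set₁ where
  field
    sig : Signature
  open Signature sig public
  open Semantics sig public
  field
    symbols₀   : 𝟎 ≢ 𝟏
    symbols₁   : ∀ x y → x · y ≢ 𝟎
    symbols₂   : ∀ x y → x · y ≢ 𝟏
    assoc      : ∀ x y z → (x · y) · z ≡ x · (y · z)
    reading    : ∀ x y → x · 𝟎 ≢ y · 𝟏
    simplif    : ∀ x₁ y₁ x₂ y₂ → x₁ · y₁ ≡ x₂ · y₂ → y₁ ≡ y₂ → x₁ ≡ x₂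
    extens     : ∀ S T → (∀ x → (x ∈ S) ⇔ (x ∈ T)) → S ≡ T
    induction  : ∀ S → 𝟎 ∈ S → 𝟏 ∈ S → (∀ x → x ∈ S → (x · 𝟎) ∈ S × (x · 𝟏) ∈ S)
               → ∀ x → x ∈ S
    -- comprehension schema: one instance per formula φ(x, x₁..xₙ, S₁..Sₘ)
    -- and per choice of parameters; S is fresh (not free in φ).
    comprehension : ∀ {n m} (φ : Formula (suc n) m) (ρ : Fin n → Word) (σ : Fin m → System)
                  → Σ System λ S → ∀ x → (x ∈ S) ⇔ sat (extend x ρ) σ φ

module Notions (M : Model) where
  open Model M

  -- a predicate on words (used for unions / singletons, which exist by comprehension)
  IsAlphabetP : (Word → Set) → Set
  IsAlphabetP P = ∀ x y z₁ z₂ → P z₁ → P z₂ →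
                  (x · z₁ ≡ y · z₂ → z₁ ≡ z₂) × (z₁ · x ≡ z₂ · y → z₁ ≡ z₂)

  Alphabet : System → Set
  Alphabet A = IsAlphabetP (λ z → z ∈ A)

  WordOver : System → Word → Set
  WordOver A w = ∀ S → (∀ a → a ∈ A → a ∈ S)
                     → (∀ x₂ x₁ → x₁ ∈ A → x₂ ∈ S → (x₂ · x₁) ∈ S) → w ∈ S

  IndependentP : (Word → Set) → (Word → Set) → Set
  IndependentP P Q = IsAlphabetP (λ z → P z ⊎ Q z) × (∀ z → P z → Q z → ⊥)

  Independent : System → System → Set
  Independent A₁ A₂ = IndependentP (λ z → z ∈ A₁) (λ z → z ∈ A₂)

  IndependentWord : Word → System → Set
  IndependentWord e A = IndependentP (λ z → z ≡ e) (λ z → z ∈ A)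

  Expressive : System → Set
  Expressive A = Alphabet A × (∃[ a ] a ∈ A)
               × (∃[ A₁ ] ∃[ A₂ ] (∀ z → z ∈ A₁ → WordOver A z)
                                × (∀ z → z ∈ A₂ → WordOver A z)
                                × Independent A₁ A₂)

  record SetFoundation : Set where
    field
      e₀ : Word
      S₀ : System
      S₀-expressive : Expressive S₀
      e₀-independent : IndependentWord e₀ S₀

  module OverFoundation (F : SetFoundation) where
    open SetFoundation F

    IsSet : Word → System → Set
    IsSet e S = WordOver S₀ e

    Elem : Word → Word → System → Set
    Elem x e S = ((x · e₀) · e) ∈ S

    -- (e)_E = (x₁,x₂)
    Assoc : Word → System → Word → Word → Set
    Assoc e E x₁ x₂ = ∀ y → Elem y e E ⇔ (y ≡ x₁ ⊎ y ≡ x₁ · x₂)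

    PairIn : Word → Word → Word → System → Set
    PairIn x₁ x₂ s S = ∃[ y ] Elem y s S × Assoc y S x₁ x₂

    IsRelation : Word → System → Word → System → Word → System → Set
    IsRelation a A b B c C =
      (∀ c₁ → Elem c₁ c C → ∃[ a₁ ] ∃[ b₁ ] Elem a₁ a A × Elem b₁ b B × Assoc c₁ C a₁ b₁)
      × (∀ c₁ c₂ a₁ b₁ → Elem c₁ c C → Elem c₂ c C →
           Assoc c₁ C a₁ b₁ → Assoc c₂ C a₁ b₁ → c₁ ≡ c₂)

    module Order (a : Word) (A : System) (r : Word) (R : System) where
      _≤o_ : Word → Word → Set
      a₁ ≤o a₂ = PairIn a₁ a₂ r R

      _<o_ : Word → Word → Set
      a₁ <o a₂ = a₁ ≤o a₂ × a₁ ≢ a₂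

      IsPartialOrder : Set
      IsPartialOrder = IsRelation a A a A r R
        × (∀ a₁ → Elem a₁ a A → a₁ ≤o a₁)
        × (∀ a₁ a₂ → Elem a₁ a A → Elem a₂ a A → a₁ ≤o a₂ → a₂ ≤o a₁ → a₁ ≡ a₂)
        × (∀ a₁ a₂ a₃ → Elem a₁ a A → Elem a₂ a A → Elem a₃ a A →
             a₁ ≤o a₂ → a₂ ≤o a₃ → a₁ ≤o a₃)

      IsTotalOrder : Set
      IsTotalOrder = IsPartialOrder
        × (∀ a₁ a₂ → Elem a₁ a A → Elem a₂ a A → a₁ ≤o a₂ ⊎ a₂ ≤o a₁)

      IsDense : Set
      IsDense = ∀ a₁ a₂ → Elem a₁ a A → Elem a₂ a A → a₁ <o a₂ →
                ∃[ a₃ ] Elem a₃ a A × a₁ <o a₃ × a₃ <o a₂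

      UpperBound : Word → System → Word → Set
      UpperBound b B x = Elem x a A × (∀ b₁ → Elem b₁ b B → b₁ ≤o x)

      LeastUpperBound : Word → System → Word → Set
      LeastUpperBound b B x = UpperBound b B x × (∀ x₁ → UpperBound b B x₁ → x ≤o x₁)

    Subset : Word → System → Word → System → Set
    Subset b B a A = ∀ y → Elem y b B → Elem y a A

Theorem6 : Set₁
Theorem6 =
  (M : Model) → ExcludedMiddle 0ℓ →
  let open Model M in
  let open Notions M in
  (F : SetFoundation) →
  let open OverFoundation F in
  (x : Word) (X : System) (t : Word) (T : System) →
  IsSet x X → IsSet t T →
  let open Order x X t T in
  IsTotalOrder → IsDense →
  (∃[ a₁ ] ∃[ a₂ ] Elem a₁ x X × Elem a₂ x X × a₁ ≢ a₂) →
  ∃[ d ] ∃[ D ] IsSet d D × Subset d D x X × ¬ (∃[ y ] LeastUpperBound d D y)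

module Submission where

-- The words form a countable universe: the
-- shortlex order (shorter words first, equal lengths colexicographically)
-- is, with excluded middle, a well-order of type ω.  The proof is the
-- nested-interval argument against completeness of countable dense orders.
--
-- Each system is obtained by comprehension from an explicit formula whose
-- satisfaction unfolds definitionally to the intended predicate.

open import Defs
open import Level using (0ℓ)
open import Data.Nat using (ℕ; zero; suc; _+_)
open import Data.Fin using (Fin; zero; suc)
open import Data.Empty using (⊥; ⊥-elim)
open import Data.Product using (Σ; _×_; _,_; ∃-syntax; proj₁; proj₂)
open import Data.Sum using (_⊎_; inj₁; inj₂)
open import Relation.Nullary using (¬_; yes; no)
open import Relation.Binary.PropositionalEquality using (_≡_; _≢_; refl; sym; trans; cong; subst; subst₂)
open import Function.Bundles using (_⇔_; Equivalence; mk⇔)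
open import Axiom.ExcludedMiddle using (ExcludedMiddle)

v0 : ∀ {n} → Term (suc n)
v0 = var zero
v1 : ∀ {n} → Term (suc (suc n))
v1 = var (suc zero)
v2 : ∀ {n} → Term (suc (suc (suc n)))
v2 = var (suc (suc zero))
v3 : ∀ {n} → Term (suc (suc (suc (suc n))))
v3 = var (suc (suc (suc zero)))
v4 : ∀ {n} → Term (suc (suc (suc (suc (suc n)))))
v4 = var (suc (suc (suc (suc zero))))
v5 : ∀ {n} → Term (suc (suc (suc (suc (suc (suc n))))))
v5 = var (suc (suc (suc (suc (suc zero)))))
s0 : ∀ {m} → Fin (suc m)
s0 = zero
s1 : ∀ {m} → Fin (suc (suc m))
s1 = suc zero
s2 : ∀ {m} → Fin (suc (suc (suc m)))
s2 = suc (suc zero)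
s3 : ∀ {m} → Fin (suc (suc (suc (suc m))))
s3 = suc (suc (suc zero))

infix 8 _≐_ _∈'_
infixr 6 _∧'_
infixr 5 _∨'_
infixr 4 _⇒'_

_≐_ : ∀ {n m} → Term n → Term n → Formula n m
_≐_ = eqW
_∈'_ : ∀ {n m} → Term n → Fin m → Formula n m
_∈'_ = memb
_∧'_ _∨'_ _⇒'_ : ∀ {n m} → Formula n m → Formula n m → Formula n m
_∧'_ = _∧f_
_∨'_ = _∨f_
_⇒'_ = _⇒f_

¬' : ∀ {n m} → Formula n m → Formula n m
¬' φ = φ ⇒f falsum

wkT : ∀ {n} → Term n → Term (suc n)
wkT (var i) = var (suc i)
wkT c0 = c0
wkT c1 = c1
wkT (s ⊙ t) = wkT s ⊙ wkT t

module Words (M : Model) where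
  open Model M
  open Equivalence

  noWords : Fin 0 → Word
  noWords ()

  noSystems : Fin 0 → System
  noSystems ()

  -- Word induction for a property given by a formula: comprehension makes
  -- the property a system, to which the induction axiom applies.
  definableInduction : ∀ {n m} (φ : Formula (suc n) m) (ρ : Fin n → Word) (σ : Fin m → System)
    → sat (extend 𝟎 ρ) σ φ → sat (extend 𝟏 ρ) σ φ
    → (∀ x → sat (extend x ρ) σ φ → sat (extend (x · 𝟎) ρ) σ φ × sat (extend (x · 𝟏) ρ) σ φ)
    → ∀ x → sat (extend x ρ) σ φ
  definableInduction φ ρ σ h𝟎 h𝟏 hs with comprehension φ ρ σ
  ... | (S , eq) = λ x → to (eq x) (induction S (from (eq 𝟎) h𝟎) (from (eq 𝟏) h𝟏) step x)
    where
    step : ∀ y → y ∈ S → (y · 𝟎) ∈ S × (y · 𝟏) ∈ S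
    step y yS = let (a , b) = hs y (to (eq y) yS) in from (eq (y · 𝟎)) a , from (eq (y · 𝟏)) b

  Letter : Word → Set
  Letter a = a ≡ 𝟎 ⊎ a ≡ 𝟏

  fLetter : ∀ {n m} → Term n → Formula n m
  fLetter a = a ≐ c0 ∨' a ≐ c1

  letter𝟎 : Letter 𝟎
  letter𝟎 = inj₁ refl

  letter𝟏 : Letter 𝟏
  letter𝟏 = inj₂ refl

  letterInduction : ∀ {n m} (φ : Formula (suc n) m) (ρ : Fin n → Word) (σ : Fin m → System)
    → (∀ a → Letter a → sat (extend a ρ) σ φ)
    → (∀ x a → Letter a → sat (extend x ρ) σ φ → sat (extend (x · a) ρ) σ φ)
    → ∀ x → sat (extend x ρ) σ φ
  letterInduction φ ρ σ hb hs =
    definableInduction φ ρ σ (hb 𝟎 letter𝟎) (hb 𝟏 letter𝟏) (λ x h → hs x 𝟎 letter𝟎 h , hs x 𝟏 letter𝟏 h)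

  snocView : ∀ w → Letter w ⊎ ∃[ x ] ∃[ a ] Letter a × w ≡ x · a
  snocView = letterInduction (fLetter v0 ∨' exW (exW (fLetter v0 ∧' v2 ≐ v1 ⊙ v0))) noWords noSystems
    (λ a la → inj₁ la) (λ x a la _ → inj₂ (x , a , la , refl))

  snocInj : ∀ {x y a b} → Letter a → Letter b → x · a ≡ y · b → a ≡ b × x ≡ y
  snocInj {x} {y} (inj₁ refl) (inj₁ refl) e = refl , simplif x 𝟎 y 𝟎 e refl
  snocInj (inj₁ refl) (inj₂ refl) e = ⊥-elim (reading _ _ e)
  snocInj (inj₂ refl) (inj₁ refl) e = ⊥-elim (reading _ _ (sym e))
  snocInj {x} {y} (inj₂ refl) (inj₂ refl) e = refl , simplif x 𝟏 y 𝟏 e refl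

  peel𝟎 : ∀ {x y} → x · 𝟎 ≡ y · 𝟎 → x ≡ y
  peel𝟎 e = proj₂ (snocInj letter𝟎 letter𝟎 e)

  letter≢product : ∀ {x y a} → Letter a → x · y ≢ a
  letter≢product (inj₁ refl) e = symbols₁ _ _ e
  letter≢product (inj₂ refl) e = symbols₂ _ _ e

  x·y≢x : ∀ x y → x · y ≢ x
  x·y≢x = letterInduction (allW (¬' (v1 ⊙ v0 ≐ v1))) noWords noSystems
    (λ a la y → letter≢product la) step
    where
    step : ∀ x a → Letter a → (∀ y → x · y ≢ x) → ∀ y → (x · a) · y ≢ x · a
    step x a la ih y e with snocView y
    ... | inj₁ lb = ih a (proj₂ (snocInj lb la e))
    ... | inj₂ (y' , b , lb , refl) =
      ih (a · y') (trans (sym (assoc x a y')) (proj₂ (snocInj lb la (trans (assoc (x · a) y' b) e))))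

  ·-cancelˡ : ∀ {z x y} → z · x ≡ z · y → x ≡ y
  ·-cancelˡ {z} {x} {y} = cancel y z x
    where
    base : ∀ b → Letter b → ∀ z x → z · x ≡ z · b → x ≡ b
    base b lb z x e with snocView x
    ... | inj₁ la = proj₁ (snocInj la lb e)
    ... | inj₂ (x' , a , la , refl) = ⊥-elim (x·y≢x z x' (proj₂ (snocInj la lb (trans (assoc z x' a) e))))
    step : ∀ y b → Letter b → (∀ z x → z · x ≡ z · y → x ≡ y) → ∀ z x → z · x ≡ z · (y · b) → x ≡ y · b
    step y b lb ih z x e with snocView x
    ... | inj₁ la = ⊥-elim (x·y≢x z y (sym (proj₂ (snocInj la lb (trans e (sym (assoc z y b)))))))
    ... | inj₂ (x' , a , la , refl) =
      let (p , q) = snocInj la lb (trans (assoc z x' a) (trans e (sym (assoc z y b))))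
      in subst (λ c → x' · a ≡ y · c) p (cong (_· a) (ih z x' q))
    cancel : ∀ y z x → z · x ≡ z · y → x ≡ y
    cancel = letterInduction (allW (allW ((v1 ⊙ v0 ≐ v1 ⊙ v2) ⇒' v0 ≐ v2))) noWords noSystems base step

  -- Numerals 𝟎, 𝟎𝟎, 𝟎𝟎𝟎, …: they serve as lengths of words.

  Numeral : Word → Set
  Numeral w = (S : System) → 𝟎 ∈ S → ((x : Word) → x ∈ S → (x · 𝟎) ∈ S) → w ∈ S

  fNumeral : Formula 1 0
  fNumeral = allS ((c0 ∈' s0) ⇒' allW ((v0 ∈' s0) ⇒' (v0 ⊙ c0 ∈' s0)) ⇒' (v0 ∈' s0))

  numeralSystem : Σ System λ S → ∀ x → (x ∈ S) ⇔ Numeral x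
  numeralSystem = comprehension fNumeral noWords noSystems

  Numerals : System
  Numerals = proj₁ numeralSystem

  toNumerals : ∀ {x} → Numeral x → x ∈ Numerals
  toNumerals {x} = from (proj₂ numeralSystem x)

  fromNumerals : ∀ {x} → x ∈ Numerals → Numeral x
  fromNumerals {x} = to (proj₂ numeralSystem x)

  withNumerals : Fin 1 → System
  withNumerals = extend Numerals noSystems

  numeral𝟎 : Numeral 𝟎
  numeral𝟎 S h𝟎 hs = h𝟎

  numeralSuc : ∀ {z} → Numeral z → Numeral (z · 𝟎)
  numeralSuc {z} h S h𝟎 hs = hs z (h S h𝟎 hs)

  -- Induction over numerals whose step may assume its argument is a numeral
  -- (apply the closure property to the intersection with `Numerals`).
  numeralInduction : ∀ {n m} (φ : Formula (suc n) m) (ρ : Fin n → Word) (σ : Fin m → System)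
    → sat (extend 𝟎 ρ) σ φ → (∀ x → Numeral x → sat (extend x ρ) σ φ → sat (extend (x · 𝟎) ρ) σ φ)
    → ∀ z → Numeral z → sat (extend z ρ) σ φ
  numeralInduction φ ρ σ h𝟎 hs z hz with comprehension φ ρ σ
  ... | (S , eq) with comprehension ((v0 ∈' s0) ∧' (v0 ∈' s1)) noWords (extend S withNumerals)
  ...   | (S∩N , eq∩) = to (eq z) (proj₁ (to (eq∩ z) (hz S∩N base step)))
    where
    base : 𝟎 ∈ S∩N
    base = from (eq∩ 𝟎) (from (eq 𝟎) h𝟎 , toNumerals numeral𝟎)
    step : ∀ x → x ∈ S∩N → (x · 𝟎) ∈ S∩N
    step x x∈ with to (eq∩ x) x∈
    ... | (xS , xN) = from (eq∩ (x · 𝟎)) (from (eq (x · 𝟎)) (hs x (fromNumerals xN) (to (eq x) xS))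
                                          , toNumerals (numeralSuc (fromNumerals xN)))

  numeralView : ∀ {w} → Numeral w → w ≡ 𝟎 ⊎ ∃[ z ] Numeral z × w ≡ z · 𝟎
  numeralView {w} hw with numeralInduction (v0 ≐ c0 ∨' exW ((v0 ∈' s0) ∧' v1 ≐ v0 ⊙ c0)) noWords withNumerals
                            (inj₁ refl) (λ x hx _ → inj₂ (x , toNumerals hx , refl)) w hw
  ... | inj₁ e = inj₁ e
  ... | inj₂ (z , hz , e) = inj₂ (z , fromNumerals hz , e)

  -- A word followed by a numeral ends in 𝟎, so it never ends in 𝟏.
  numeralEnds𝟎 : ∀ {z} → Numeral z → ∀ u y → u · 𝟏 ≢ y · z
  numeralEnds𝟎 hz u y e with numeralView hz
  ... | inj₁ refl = reading y u (sym e)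
  ... | inj₂ (z' , _ , refl) = reading (y · z') u (trans (assoc y z' 𝟎) (sym e))

  markerInj : ∀ {z} → Numeral z → ∀ u u' z' → Numeral z' → (u · 𝟏) · z ≡ (u' · 𝟏) · z' → u ≡ u' × z ≡ z'
  markerInj {z} hz u u' z' hz' = inj z hz u u' z' (toNumerals hz')
    where
    base : ∀ u u' z' → z' ∈ Numerals → (u · 𝟏) · 𝟎 ≡ (u' · 𝟏) · z' → u ≡ u' × 𝟎 ≡ z'
    base u u' z' hz' e with numeralView (fromNumerals hz')
    ... | inj₁ refl = proj₂ (snocInj letter𝟏 letter𝟏 (peel𝟎 e)) , refl
    ... | inj₂ (z'' , hz'' , refl) = ⊥-elim (numeralEnds𝟎 hz'' u (u' · 𝟏) (peel𝟎 (trans e (sym (assoc (u' · 𝟏) z'' 𝟎)))))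
    step : ∀ x → Numeral x → (∀ u u' z' → z' ∈ Numerals → (u · 𝟏) · x ≡ (u' · 𝟏) · z' → u ≡ u' × x ≡ z')
         → ∀ u u' z' → z' ∈ Numerals → (u · 𝟏) · (x · 𝟎) ≡ (u' · 𝟏) · z' → u ≡ u' × x · 𝟎 ≡ z'
    step x hx ih u u' z' hz' e with numeralView (fromNumerals hz')
    ... | inj₁ refl = ⊥-elim (numeralEnds𝟎 hx u' (u · 𝟏) (sym (peel𝟎 (trans (assoc (u · 𝟏) x 𝟎) e))))
    ... | inj₂ (z'' , hz'' , refl) =
      let (p , q) = ih u u' z'' (toNumerals hz'') (peel𝟎 (trans (assoc (u · 𝟏) x 𝟎) (trans e (sym (assoc (u' · 𝟏) z'' 𝟎)))))
      in p , cong (_· 𝟎) q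
    inj : ∀ z → Numeral z → ∀ u u' z' → z' ∈ Numerals → (u · 𝟏) · z ≡ (u' · 𝟏) · z' → u ≡ u' × z ≡ z'
    inj = numeralInduction (allW (allW (allW ((v0 ∈' s0) ⇒' ((v2 ⊙ c1) ⊙ v3 ≐ (v1 ⊙ c1) ⊙ v0) ⇒' (v2 ≐ v1 ∧' v3 ≐ v0)))))
            noWords withNumerals base step

  -- z ⊏ z' : z is a proper prefix of z'.  On numerals this is the order of
  -- the natural numbers.
  _⊏_ : Word → Word → Set
  z ⊏ z' = ∃[ y ] z' ≡ z · y

  _⊑_ : Word → Word → Set
  z ⊑ z' = z ≡ z' ⊎ z ⊏ z'

  f⊑ : ∀ {n m} → Term n → Term n → Formula n m
  f⊑ s t = s ≐ t ∨' exW (wkT t ≐ wkT s ⊙ v0)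

  ⊏-irrefl : ∀ {z} → ¬ (z ⊏ z)
  ⊏-irrefl {z} (y , e) = x·y≢x z y (sym e)

  ⊏-trans : ∀ {a b c} → a ⊏ b → b ⊏ c → a ⊏ c
  ⊏-trans {a} (y , refl) (y' , refl) = y · y' , assoc a y y'

  ⊏-suc : ∀ {z} → z ⊏ (z · 𝟎)
  ⊏-suc = 𝟎 , refl

  ⊏-suc⁻ : ∀ {y z} → y ⊏ (z · 𝟎) → y ⊑ z
  ⊏-suc⁻ {y} {z} (t , e) with snocView t
  ... | inj₁ lb = inj₁ (sym (proj₂ (snocInj letter𝟎 lb e)))
  ... | inj₂ (t' , b , lb , refl) = inj₂ (t' , proj₂ (snocInj letter𝟎 lb (trans e (sym (assoc y t' b)))))

  ¬⊏𝟎 : ∀ {y} → ¬ (y ⊏ 𝟎)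
  ¬⊏𝟎 (t , e) = symbols₁ _ _ (sym e)

  𝟎⊑numeral : ∀ {z} → Numeral z → 𝟎 ⊑ z
  𝟎⊑numeral {z} = numeralInduction (c0 ≐ v0 ∨' exW (v1 ≐ c0 ⊙ v0)) noWords noSystems (inj₁ refl) step z
    where
    step : ∀ x → Numeral x → 𝟎 ⊑ x → 𝟎 ⊑ (x · 𝟎)
    step x _ (inj₁ refl) = inj₂ ⊏-suc
    step x _ (inj₂ (y , refl)) = inj₂ (y · 𝟎 , assoc 𝟎 y 𝟎)

  ⊏-suc-⊑ : ∀ {z z'} → Numeral z → z' ⊏ z → (z' · 𝟎) ⊑ z
  ⊏-suc-⊑ {z} {z'} hz = go z hz z'
    where
    step : ∀ x → Numeral x → (∀ z' → z' ⊏ x → (z' · 𝟎) ⊑ x) → ∀ z' → z' ⊏ (x · 𝟎) → (z' · 𝟎) ⊑ (x · 𝟎)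
    step x _ ih z' lt with ⊏-suc⁻ lt
    ... | inj₁ refl = inj₁ refl
    ... | inj₂ lt' with ih z' lt'
    ...   | inj₁ refl = inj₂ ⊏-suc
    ...   | inj₂ lt'' = inj₂ (⊏-trans lt'' ⊏-suc)
    go : ∀ z → Numeral z → ∀ z' → z' ⊏ z → (z' · 𝟎) ⊑ z
    go = numeralInduction (allW (exW (v2 ≐ v1 ⊙ v0) ⇒' ((v0 ⊙ c0 ≐ v1) ∨' exW (v2 ≐ (v1 ⊙ c0) ⊙ v0))))
           noWords noSystems (λ z' lt → ⊥-elim (¬⊏𝟎 lt)) step

  numeralTrichotomy : ∀ {z z'} → Numeral z → Numeral z' → z ⊏ z' ⊎ z ≡ z' ⊎ z' ⊏ z
  numeralTrichotomy {z} {z'} hz hz' = tri z' hz' z (toNumerals hz)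
    where
    base : ∀ z → z ∈ Numerals → z ⊏ 𝟎 ⊎ z ≡ 𝟎 ⊎ 𝟎 ⊏ z
    base z hz with 𝟎⊑numeral (fromNumerals hz)
    ... | inj₁ e = inj₂ (inj₁ (sym e))
    ... | inj₂ lt = inj₂ (inj₂ lt)
    step : ∀ x → Numeral x → (∀ z → z ∈ Numerals → z ⊏ x ⊎ z ≡ x ⊎ x ⊏ z)
         → ∀ z → z ∈ Numerals → z ⊏ (x · 𝟎) ⊎ z ≡ (x · 𝟎) ⊎ (x · 𝟎) ⊏ z
    step x _ ih z hz with ih z hz
    ... | inj₁ lt = inj₁ (⊏-trans lt ⊏-suc)
    ... | inj₂ (inj₁ refl) = inj₁ ⊏-suc
    ... | inj₂ (inj₂ lt) with ⊏-suc-⊑ (fromNumerals hz) lt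
    ...   | inj₁ e = inj₂ (inj₁ (sym e))
    ...   | inj₂ lt' = inj₂ (inj₂ lt')
    tri : ∀ z' → Numeral z' → ∀ z → z ∈ Numerals → z ⊏ z' ⊎ z ≡ z' ⊎ z' ⊏ z
    tri = numeralInduction (allW ((v0 ∈' s0) ⇒' (exW (v2 ≐ v1 ⊙ v0) ∨' v0 ≐ v1 ∨' exW (v1 ≐ v2 ⊙ v0))))
            noWords withNumerals base step

  -- The length relation is coded by the system of words (u𝟏)z, z the numeral
  -- with as many letters as u: the least system containing (a𝟏)𝟎 for letters
  -- a and closed under (u𝟏)z ↦ ((ua)𝟏)(z𝟎).
  LengthCode : Word → Set
  LengthCode w = (S : System) → ((𝟎 · 𝟏) · 𝟎) ∈ S → ((𝟏 · 𝟏) · 𝟎) ∈ S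
    → ((u z : Word) → z ∈ Numerals → ((u · 𝟏) · z) ∈ S
         → (((u · 𝟎) · 𝟏) · (z · 𝟎)) ∈ S × (((u · 𝟏) · 𝟏) · (z · 𝟎)) ∈ S)
    → w ∈ S

  fLengthCode : Formula 1 1
  fLengthCode = allS (((c0 ⊙ c1) ⊙ c0 ∈' s0) ⇒' ((c1 ⊙ c1) ⊙ c0 ∈' s0) ⇒'
    allW (allW ((v0 ∈' s1) ⇒' ((v1 ⊙ c1) ⊙ v0 ∈' s0) ⇒'
      (((v1 ⊙ c0) ⊙ c1) ⊙ (v0 ⊙ c0) ∈' s0 ∧' ((v1 ⊙ c1) ⊙ c1) ⊙ (v0 ⊙ c0) ∈' s0))) ⇒' (v0 ∈' s0))

  lengthCodeSystem : Σ System λ S → ∀ x → (x ∈ S) ⇔ LengthCode x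
  lengthCodeSystem = comprehension fLengthCode noWords withNumerals

  LengthCodes : System
  LengthCodes = proj₁ lengthCodeSystem

  toLengthCodes : ∀ {x} → LengthCode x → x ∈ LengthCodes
  toLengthCodes {x} = from (proj₂ lengthCodeSystem x)

  fromLengthCodes : ∀ {x} → x ∈ LengthCodes → LengthCode x
  fromLengthCodes {x} = to (proj₂ lengthCodeSystem x)

  withLengths : Fin 2 → System
  withLengths = extend LengthCodes withNumerals

  -- Len u z : the numeral z has as many letters as u.  It is stated through
  -- membership so that it is definable (by `fLen`).
  Len : Word → Word → Set
  Len u z = z ∈ Numerals × ((u · 𝟏) · z) ∈ LengthCodes

  fLen : ∀ {n m} → Term n → Term n → Fin m → Fin m → Formula n m
  fLen u z iL iZ = (z ∈' iZ) ∧' ((u ⊙ c1) ⊙ z ∈' iL)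

  len-letter : ∀ {a} → Letter a → Len a 𝟎
  len-letter la = toNumerals numeral𝟎 , toLengthCodes (code la)
    where
    code : ∀ {a} → Letter a → LengthCode ((a · 𝟏) · 𝟎)
    code (inj₁ refl) S h𝟎 h𝟏 hs = h𝟎
    code (inj₂ refl) S h𝟎 h𝟏 hs = h𝟏

  len-snoc : ∀ {u z a} → Letter a → Len u z → Len (u · a) (z · 𝟎)
  len-snoc {u} {z} la (hz , hl) =
    toNumerals (numeralSuc (fromNumerals hz)) ,
    toLengthCodes (λ S h𝟎 h𝟏 hs → pick la (hs u z hz (fromLengthCodes hl S h𝟎 h𝟏 hs)))
    where
    pick : ∀ {a} {S : System} → Letter a
         → (((u · 𝟎) · 𝟏) · (z · 𝟎)) ∈ S × (((u · 𝟏) · 𝟏) · (z · 𝟎)) ∈ S → (((u · a) · 𝟏) · (z · 𝟎)) ∈ S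
    pick (inj₁ refl) = proj₁
    pick (inj₂ refl) = proj₂

  lengthCodeView : ∀ {w} → w ∈ LengthCodes
    → (∃[ a ] Letter a × w ≡ (a · 𝟏) · 𝟎)
    ⊎ (∃[ u ] ∃[ z ] ∃[ a ] Letter a × Len u z × w ≡ ((u · a) · 𝟏) · (z · 𝟎))
  lengthCodeView {w} hw with comprehension φ noWords withLengths
    where
    φ : Formula 1 2
    φ = (v0 ∈' s0) ∧' (exW (fLetter v0 ∧' v1 ≐ (v0 ⊙ c1) ⊙ c0)
        ∨' exW (exW (exW (fLetter v0 ∧' fLen v2 v1 s0 s1 ∧' v3 ≐ ((v2 ⊙ v0) ⊙ c1) ⊙ (v1 ⊙ c0)))))
  ... | (S , eq) = proj₂ (to (eq w) (fromLengthCodes hw S (base letter𝟎) (base letter𝟏) step))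
    where
    base : ∀ {a} → Letter a → ((a · 𝟏) · 𝟎) ∈ S
    base {a} la = from (eq _) (proj₂ (len-letter la) , inj₁ (a , la , refl))
    grow : ∀ u z a → Letter a → Len u z → (((u · a) · 𝟏) · (z · 𝟎)) ∈ S
    grow u z a la h = from (eq _) (proj₂ (len-snoc la h) , inj₂ (u , z , a , la , h , refl))
    step : ∀ u z → z ∈ Numerals → ((u · 𝟏) · z) ∈ S
         → (((u · 𝟎) · 𝟏) · (z · 𝟎)) ∈ S × (((u · 𝟏) · 𝟏) · (z · 𝟎)) ∈ S
    step u z hz uS = grow u z 𝟎 letter𝟎 (hz , proj₁ (to (eq _) uS)) , grow u z 𝟏 letter𝟏 (hz , proj₁ (to (eq _) uS))

  lenView : ∀ {u z} → Len u z
    → (Letter u × z ≡ 𝟎) ⊎ (∃[ u' ] ∃[ z' ] ∃[ a ] Letter a × Len u' z' × u ≡ u' · a × z ≡ z' · 𝟎)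
  lenView {u} {z} (hz , hl) with lengthCodeView hl
  ... | inj₁ (a , la , e) =
    let (p , q) = markerInj (fromNumerals hz) u a 𝟎 numeral𝟎 e in inj₁ (subst Letter (sym p) la , q)
  ... | inj₂ (u' , z' , a , la , h' , e) =
    let (p , q) = markerInj (fromNumerals hz) u (u' · a) (z' · 𝟎) (numeralSuc (fromNumerals (proj₁ h'))) e
    in inj₂ (u' , z' , a , la , h' , p , q)

  len-letter⁻ : ∀ {a z} → Letter a → Len a z → z ≡ 𝟎
  len-letter⁻ la h with lenView h
  ... | inj₁ (_ , e) = e
  ... | inj₂ (_ , _ , _ , _ , _ , e , _) = ⊥-elim (letter≢product la (sym e))

  len-snoc⁻ : ∀ {u a z} → Letter a → Len (u · a) z → ∃[ z' ] Len u z' × z ≡ z' · 𝟎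
  len-snoc⁻ la h with lenView h
  ... | inj₁ (lu , _) = ⊥-elim (letter≢product lu refl)
  ... | inj₂ (u' , z' , b , lb , h' , e , q) = z' , subst (λ y → Len y z') (sym (proj₂ (snocInj la lb e))) h' , q

  len-𝟎⁻ : ∀ {u} → Len u 𝟎 → Letter u
  len-𝟎⁻ h with lenView h
  ... | inj₁ (lu , _) = lu
  ... | inj₂ (_ , _ , _ , _ , _ , _ , e) = ⊥-elim (symbols₁ _ _ (sym e))

  len-suc⁻ : ∀ {u z} → Len u (z · 𝟎) → ∃[ u' ] ∃[ a ] Letter a × u ≡ u' · a × Len u' z
  len-suc⁻ {u} h with snocView u
  ... | inj₁ lu = ⊥-elim (symbols₁ _ _ (len-letter⁻ lu h))
  ... | inj₂ (u' , a , la , refl) with len-snoc⁻ la h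
  ...   | (z' , h' , e) = u' , a , la , refl , subst (Len u') (sym (peel𝟎 e)) h'

  LenFunctional : Word → Set
  LenFunctional u = ∀ z z' → Len u z → Len u z' → z ≡ z'

  len-functional : ∀ {u z z'} → Len u z → Len u z' → z ≡ z'
  len-functional {u} {z} {z'} = functional u z z'
    where
    base : ∀ a → Letter a → LenFunctional a
    base a la z z' h h' = trans (len-letter⁻ la h) (sym (len-letter⁻ la h'))
    step : ∀ x a → Letter a → LenFunctional x → LenFunctional (x · a)
    step x a la ih z z' h h' with len-snoc⁻ la h | len-snoc⁻ la h'
    ... | (z₁ , h₁ , refl) | (z₂ , h₂ , refl) = cong (_· 𝟎) (ih z₁ z₂ h₁ h₂)
    functional : ∀ u → LenFunctional u
    functional = letterInduction (allW (allW (fLen v2 v1 s0 s1 ⇒' fLen v2 v0 s0 s1 ⇒' v1 ≐ v0))) noWords withLengths base step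

  len-total : ∀ u → ∃[ z ] Len u z
  len-total = letterInduction (exW (fLen v1 v0 s0 s1)) noWords withLengths
    (λ a la → 𝟎 , len-letter la) (λ x a la (z , h) → z · 𝟎 , len-snoc la h)

  -- Colex u v : u = p𝟎s and v = q𝟏s for a common suffix s (p, q, s possibly
  -- empty).  On words of equal length this is the colexicographic order.
  Colex : Word → Word → Set
  Colex u v = (u ≡ 𝟎 × v ≡ 𝟏)
            ⊎ (∃[ p ] ∃[ q ] u ≡ p · 𝟎 × v ≡ q · 𝟏)
            ⊎ (∃[ s ] u ≡ 𝟎 · s × v ≡ 𝟏 · s)
            ⊎ (∃[ p ] ∃[ q ] ∃[ s ] u ≡ (p · 𝟎) · s × v ≡ (q · 𝟏) · s)

  fColex : ∀ {n m} → Term n → Term n → Formula n m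
  fColex s t = (s ≐ c0 ∧' t ≐ c1)
    ∨' exW (exW (wkT (wkT s) ≐ v1 ⊙ c0 ∧' wkT (wkT t) ≐ v0 ⊙ c1))
    ∨' exW (wkT s ≐ c0 ⊙ v0 ∧' wkT t ≐ c1 ⊙ v0)
    ∨' exW (exW (exW (wkT (wkT (wkT s)) ≐ (v2 ⊙ c0) ⊙ v0 ∧' wkT (wkT (wkT t)) ≐ (v1 ⊙ c1) ⊙ v0)))

  colex-snoc⁻ : ∀ {u v a b} → Letter a → Letter b → Colex (u · a) (v · b) → (a ≡ 𝟎 × b ≡ 𝟏) ⊎ (a ≡ b × Colex u v)
  colex-snoc⁻ la lb (inj₁ (e , _)) = ⊥-elim (letter≢product letter𝟎 e)
  colex-snoc⁻ la lb (inj₂ (inj₁ (p , q , e₁ , e₂))) = inj₁ (proj₁ (snocInj la letter𝟎 e₁) , proj₁ (snocInj lb letter𝟏 e₂))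
  colex-snoc⁻ la lb (inj₂ (inj₂ (inj₁ (s , e₁ , e₂)))) with snocView s
  ... | inj₁ lc = let (p₁ , q₁) = snocInj la lc e₁ ; (p₂ , q₂) = snocInj lb lc e₂ in
                  inj₂ (trans p₁ (sym p₂) , inj₁ (q₁ , q₂))
  ... | inj₂ (s' , c , lc , refl) =
        let (p₁ , q₁) = snocInj la lc (trans e₁ (sym (assoc 𝟎 s' c)))
            (p₂ , q₂) = snocInj lb lc (trans e₂ (sym (assoc 𝟏 s' c)))
        in inj₂ (trans p₁ (sym p₂) , inj₂ (inj₂ (inj₁ (s' , q₁ , q₂))))
  colex-snoc⁻ la lb (inj₂ (inj₂ (inj₂ (p , q , s , e₁ , e₂)))) with snocView s
  ... | inj₁ lc = let (p₁ , q₁) = snocInj la lc e₁ ; (p₂ , q₂) = snocInj lb lc e₂ in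
                  inj₂ (trans p₁ (sym p₂) , inj₂ (inj₁ (p , q , q₁ , q₂)))
  ... | inj₂ (s' , c , lc , refl) =
        let (p₁ , q₁) = snocInj la lc (trans e₁ (sym (assoc (p · 𝟎) s' c)))
            (p₂ , q₂) = snocInj lb lc (trans e₂ (sym (assoc (q · 𝟏) s' c)))
        in inj₂ (trans p₁ (sym p₂) , inj₂ (inj₂ (inj₂ (p , q , s' , q₁ , q₂))))

  colex-snoc : ∀ {u v a b} → (a ≡ 𝟎 × b ≡ 𝟏) ⊎ (a ≡ b × Colex u v) → Colex (u · a) (v · b)
  colex-snoc {u} {v} (inj₁ (refl , refl)) = inj₂ (inj₁ (u , v , refl , refl))
  colex-snoc {a = a} (inj₂ (refl , inj₁ (refl , refl))) = inj₂ (inj₂ (inj₁ (a , refl , refl)))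
  colex-snoc {a = a} (inj₂ (refl , inj₂ (inj₁ (p , q , refl , refl)))) = inj₂ (inj₂ (inj₂ (p , q , a , refl , refl)))
  colex-snoc {a = a} (inj₂ (refl , inj₂ (inj₂ (inj₁ (s , refl , refl))))) =
    inj₂ (inj₂ (inj₁ (s · a , assoc 𝟎 s a , assoc 𝟏 s a)))
  colex-snoc {a = a} (inj₂ (refl , inj₂ (inj₂ (inj₂ (p , q , s , refl , refl))))) =
    inj₂ (inj₂ (inj₂ (p , q , s · a , assoc (p · 𝟎) s a , assoc (q · 𝟏) s a)))

  colex-letter⁻ : ∀ {a v} → Letter a → Colex a v → a ≡ 𝟎 × v ≡ 𝟏
  colex-letter⁻ la (inj₁ r) = r
  colex-letter⁻ la (inj₂ (inj₁ (p , q , e , _))) = ⊥-elim (letter≢product la (sym e))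
  colex-letter⁻ la (inj₂ (inj₂ (inj₁ (s , e , _)))) = ⊥-elim (letter≢product la (sym e))
  colex-letter⁻ la (inj₂ (inj₂ (inj₂ (p , q , s , e , _)))) = ⊥-elim (letter≢product la (sym e))

  ¬colex-product-letter : ∀ {u a b} → Letter b → ¬ Colex (u · a) b
  ¬colex-product-letter lb (inj₁ (e , _)) = letter≢product letter𝟎 e
  ¬colex-product-letter lb (inj₂ (inj₁ (p , q , _ , e))) = letter≢product lb (sym e)
  ¬colex-product-letter lb (inj₂ (inj₂ (inj₁ (s , _ , e)))) = letter≢product lb (sym e)
  ¬colex-product-letter lb (inj₂ (inj₂ (inj₂ (p , q , s , _ , e)))) = letter≢product lb (sym e)

  colex-asym : ∀ {u v} → Colex u v → Colex v u → ⊥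
  colex-asym {u} {v} = asym u v
    where
    base : ∀ a → Letter a → ∀ v → Colex a v → Colex v a → ⊥
    base a la v c c' =
      let (a≡𝟎 , v≡𝟏) = colex-letter⁻ la c in symbols₀ (trans (sym a≡𝟎) (proj₂ (colex-letter⁻ (inj₂ v≡𝟏) c')))
    step : ∀ x a → Letter a → (∀ v → Colex x v → Colex v x → ⊥) → ∀ v → Colex (x · a) v → Colex v (x · a) → ⊥
    step x a la ih v c c' with snocView v
    ... | inj₁ lb = ¬colex-product-letter lb c
    ... | inj₂ (v' , b , lb , refl) with colex-snoc⁻ la lb c | colex-snoc⁻ lb la c'
    ...   | inj₁ (p , q) | inj₁ (p' , q') = symbols₀ (trans (sym p') q)
    ...   | inj₁ (p , q) | inj₂ (e , _) = symbols₀ (trans (sym p) (trans (sym e) q))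
    ...   | inj₂ (e , _) | inj₁ (p' , q') = symbols₀ (trans (sym p') (trans (sym e) q'))
    ...   | inj₂ (_ , c₁) | inj₂ (_ , c₂) = ih v' c₁ c₂
    asym : ∀ u v → Colex u v → Colex v u → ⊥
    asym = letterInduction (allW (fColex v1 v0 ⇒' fColex v0 v1 ⇒' falsum)) noWords noSystems base step

  Prec : Word → Word → Set
  Prec u v = (∃[ z ] ∃[ z' ] Len u z × Len v z' × z ⊏ z') ⊎ (∃[ z ] Len u z × Len v z × Colex u v)

  fPrec : ∀ {n m} → Term n → Term n → Fin m → Fin m → Formula n m
  fPrec s t iL iZ =
    exW (exW (fLen (wkT (wkT s)) v1 iL iZ ∧' fLen (wkT (wkT t)) v0 iL iZ ∧' exW (v1 ≐ v2 ⊙ v0)))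
    ∨' exW (fLen (wkT s) v0 iL iZ ∧' fLen (wkT t) v0 iL iZ ∧' fColex (wkT s) (wkT t))

  prec-asym : ∀ {u v} → Prec u v → Prec v u → ⊥
  prec-asym (inj₁ (z₁ , z₂ , h₁ , h₂ , lt)) (inj₁ (z₃ , z₄ , h₃ , h₄ , lt'))
    rewrite len-functional h₁ h₄ | len-functional h₂ h₃ = ⊏-irrefl (⊏-trans lt lt')
  prec-asym (inj₁ (z₁ , z₂ , h₁ , h₂ , lt)) (inj₂ (z₃ , h₃ , h₄ , _))
    rewrite len-functional h₁ h₄ | len-functional h₂ h₃ = ⊏-irrefl lt
  prec-asym (inj₂ (z₃ , h₃ , h₄ , _)) (inj₁ (z₁ , z₂ , h₁ , h₂ , lt))
    rewrite len-functional h₁ h₄ | len-functional h₂ h₃ = ⊏-irrefl lt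
  prec-asym (inj₂ (_ , _ , _ , c)) (inj₂ (_ , _ , _ , c')) = colex-asym c c'

  prec-len : ∀ {u v z z'} → Prec u v → Len u z → Len v z' → z ⊑ z'
  prec-len (inj₁ (z₁ , z₂ , h₁ , h₂ , lt)) hu hv rewrite len-functional hu h₁ | len-functional hv h₂ = inj₂ lt
  prec-len (inj₂ (z₁ , h₁ , h₂ , _)) hu hv rewrite len-functional hu h₁ | len-functional hv h₂ = inj₁ refl

  preimage : (A : System) (c : Word) → Σ System λ B → ∀ u → (u ∈ B) ⇔ ((u · c) ∈ A)
  preimage A c = comprehension (v0 ⊙ v1 ∈' s0) (extend c noWords) (extend A noSystems)

  len-drop : ∀ {u a x} → Letter a → Len (u · a) (x · 𝟎) → Len u x
  len-drop la h with len-snoc⁻ la h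
  ... | (z' , h' , e) = subst (Len _) (sym (peel𝟎 e)) h'

  NoColexAscent : Word → Set
  NoColexAscent z = (A : System) → (∀ u → u ∈ A → Len u z)
    → (∀ u → u ∈ A → ∃[ v ] v ∈ A × Colex u v) → ∀ u → ¬ (u ∈ A)

  colex-noAscent : ∀ z → Numeral z → NoColexAscent z
  colex-noAscent = numeralInduction
    (allS (allW ((v0 ∈' s0) ⇒' fLen v0 v1 s1 s2) ⇒' allW ((v0 ∈' s0) ⇒' exW ((v0 ∈' s0) ∧' fColex v1 v0))
           ⇒' allW (¬' (v0 ∈' s0))))
    noWords withLengths base step
    where
    base : NoColexAscent 𝟎
    base A lenA ascent u uA with ascent u uA
    ... | (v , vA , c) with colex-letter⁻ (len-𝟎⁻ (lenA u uA)) c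
    ...   | (_ , refl) with ascent 𝟏 vA
    ...     | (_ , _ , c') = symbols₀ (sym (proj₁ (colex-letter⁻ letter𝟏 c')))
    step : ∀ x → Numeral x → NoColexAscent x → NoColexAscent (x · 𝟎)
    step x _ ih A lenA ascent = noneInA
      where
      B₀ B₁ : System
      B₀ = proj₁ (preimage A 𝟎)
      B₁ = proj₁ (preimage A 𝟏)
      e₀ : ∀ u → (u ∈ B₀) ⇔ ((u · 𝟎) ∈ A)
      e₀ = proj₂ (preimage A 𝟎)
      e₁ : ∀ u → (u ∈ B₁) ⇔ ((u · 𝟏) ∈ A)
      e₁ = proj₂ (preimage A 𝟏)
      -- a colex-larger word than u𝟏 ends in 𝟏 as well
      ascent₁ : ∀ u → u ∈ B₁ → ∃[ v ] v ∈ B₁ × Colex u v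
      ascent₁ u uB with ascent (u · 𝟏) (to (e₁ u) uB)
      ... | (v , vA , c) with len-suc⁻ (lenA v vA)
      ...   | (v' , b , lb , refl , _) with colex-snoc⁻ letter𝟏 lb c
      ...     | inj₁ (p , _) = ⊥-elim (symbols₀ (sym p))
      ...     | inj₂ (refl , c') = v' , from (e₁ v') vA , c'
      none₁ : ∀ u → ¬ (u ∈ B₁)
      none₁ = ih B₁ (λ u uB → len-drop letter𝟏 (lenA _ (to (e₁ u) uB))) ascent₁
      -- so a colex-larger word than u𝟎 ends in 𝟎
      ascent₀ : ∀ u → u ∈ B₀ → ∃[ v ] v ∈ B₀ × Colex u v
      ascent₀ u uB with ascent (u · 𝟎) (to (e₀ u) uB)
      ... | (v , vA , c) with len-suc⁻ (lenA v vA)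
      ...   | (v' , b , lb , refl , _) with colex-snoc⁻ letter𝟎 lb c
      ...     | inj₁ (_ , refl) = ⊥-elim (none₁ v' (from (e₁ v') vA))
      ...     | inj₂ (refl , c') = v' , from (e₀ v') vA , c'
      noneInA : ∀ u → ¬ (u ∈ A)
      noneInA u uA with len-suc⁻ (lenA u uA)
      ... | (u' , _ , inj₁ refl , refl , _) =
        ih B₀ (λ u uB → len-drop letter𝟎 (lenA _ (to (e₀ u) uB))) ascent₀ u' (from (e₀ u') uA)
      ... | (u' , _ , inj₂ refl , refl , _) = none₁ u' (from (e₁ u') uA)

  ofLength : (W : System) (z : Word) → Σ System λ B → ∀ u → (u ∈ B) ⇔ (u ∈ W × Len u z)
  ofLength W z = comprehension ((v0 ∈' s0) ∧' fLen v0 v1 s1 s2) (extend z noWords) (extend W withLengths)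

  lengthsOf : (W : System) → Σ System λ Λ → ∀ z → (z ∈ Λ) ⇔ (∃[ u ] u ∈ W × Len u z)
  lengthsOf W = comprehension (exW ((v0 ∈' s0) ∧' fLen v0 v1 s1 s2)) noWords (extend W withLengths)

module WellOrdering (M : Model) (em : ExcludedMiddle 0ℓ) where
  open Model M
  open Equivalence
  open Words M

  leastNumeral : (A : System) → ∃[ z ] Numeral z × z ∈ A
               → ∃[ z ] Numeral z × z ∈ A × (∀ y → Numeral y → y ∈ A → z ⊑ y)
  leastNumeral A (z , hz , zA) with em {∃[ z ] Numeral z × z ∈ A × (∀ y → Numeral y → y ∈ A → z ⊑ y)}
  ... | yes least = least
  ... | no none = ⊥-elim (below z hz z (inj₁ refl) zA)
    where
    base : ∀ y → y ⊑ 𝟎 → ¬ (y ∈ A)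
    base y (inj₁ refl) yA = none (𝟎 , numeral𝟎 , yA , λ y' hy' _ → 𝟎⊑numeral hy')
    base y (inj₂ lt) _ = ¬⊏𝟎 lt
    step : ∀ x → Numeral x → (∀ y → y ⊑ x → ¬ (y ∈ A)) → ∀ y → y ⊑ (x · 𝟎) → ¬ (y ∈ A)
    step x hx ih y (inj₂ lt) = ih y (⊏-suc⁻ lt)
    step x hx ih y (inj₁ refl) yA = none (x · 𝟎 , numeralSuc hx , yA , minimal)
      where
      minimal : ∀ y' → Numeral y' → y' ∈ A → (x · 𝟎) ⊑ y'
      minimal y' hy' y'A with numeralTrichotomy (numeralSuc hx) hy'
      ... | inj₁ lt = inj₂ lt
      ... | inj₂ (inj₁ e) = inj₁ e
      ... | inj₂ (inj₂ lt) = ⊥-elim (ih y' (⊏-suc⁻ lt) y'A)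
    below : ∀ z → Numeral z → ∀ y → y ⊑ z → ¬ (y ∈ A)
    below = numeralInduction (allW (f⊑ v0 v1 ⇒' ¬' (v0 ∈' s0))) noWords (extend A noSystems) base step

  GreatestBelow : Word → Set
  GreatestBelow b = (A : System) → ∃[ z ] z ∈ A → (∀ z → z ∈ A → z ⊑ b) → ∃[ m ] m ∈ A × (∀ z → z ∈ A → z ⊑ m)

  greatestBelow : ∀ b → Numeral b → GreatestBelow b
  greatestBelow = numeralInduction
    (allS (exW (v0 ∈' s0) ⇒' allW ((v0 ∈' s0) ⇒' f⊑ v0 v1) ⇒' exW ((v0 ∈' s0) ∧' allW ((v0 ∈' s0) ⇒' f⊑ v0 v1))))
    noWords noSystems base step
    where
    base : GreatestBelow 𝟎
    base A (w , wA) bound with bound w wA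
    ... | inj₂ lt = ⊥-elim (¬⊏𝟎 lt)
    ... | inj₁ refl = 𝟎 , wA , bound
    step : ∀ x → Numeral x → GreatestBelow x → GreatestBelow (x · 𝟎)
    step x _ ih A nonempty bound with em {(x · 𝟎) ∈ A}
    ... | yes x𝟎∈A = x · 𝟎 , x𝟎∈A , bound
    ... | no x𝟎∉A = ih A nonempty bound'
      where
      bound' : ∀ z → z ∈ A → z ⊑ x
      bound' z zA with bound z zA
      ... | inj₁ refl = ⊥-elim (x𝟎∉A zA)
      ... | inj₂ lt = ⊏-suc⁻ lt

  ColexLeast : System → Word → Set
  ColexLeast A m = m ∈ A × (∀ u → u ∈ A → m ≡ u ⊎ Colex m u)

  leastSameLast : ∀ {a m} (A B : System) → (∀ u → (u ∈ B) ⇔ ((u · a) ∈ A)) → ColexLeast B m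
    → ∀ u → (u · a) ∈ A → (m · a) ≡ (u · a) ⊎ Colex (m · a) (u · a)
  leastSameLast {a} A B eB (_ , least) u uA with least u (from (eB u) uA)
  ... | inj₁ e = inj₁ (cong (_· a) e)
  ... | inj₂ c = inj₂ (colex-snoc (inj₂ (refl , c)))

  extendLeast : ∀ {x a m} (A B : System) → Letter a → (∀ u → (u ∈ B) ⇔ ((u · a) ∈ A))
    → (∀ u → u ∈ A → Len u (x · 𝟎)) → (∀ u → (u · 𝟎) ∈ A → a ≡ 𝟎) → ColexLeast B m → ColexLeast A (m · a)
  extendLeast {m = m} A B (inj₁ refl) eB lenA smallest leastB = to (eB m) (proj₁ leastB) , compare
    where
    compare : ∀ u → u ∈ A → (m · 𝟎) ≡ u ⊎ Colex (m · 𝟎) u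
    compare u uA with len-suc⁻ (lenA u uA)
    ... | (u' , _ , inj₁ refl , refl , _) = leastSameLast A B eB leastB u' uA
    ... | (u' , _ , inj₂ refl , refl , _) = inj₂ (colex-snoc (inj₁ (refl , refl)))
  extendLeast {m = m} A B (inj₂ refl) eB lenA smallest leastB = to (eB m) (proj₁ leastB) , compare
    where
    compare : ∀ u → u ∈ A → (m · 𝟏) ≡ u ⊎ Colex (m · 𝟏) u
    compare u uA with len-suc⁻ (lenA u uA)
    ... | (u' , _ , inj₁ refl , refl , _) = ⊥-elim (symbols₀ (sym (smallest u' uA)))
    ... | (u' , _ , inj₂ refl , refl , _) = leastSameLast A B eB leastB u' uA

  HasColexLeast : Word → Set
  HasColexLeast z = (A : System) → ∃[ u ] u ∈ A → (∀ u → u ∈ A → Len u z) → ∃[ m ] ColexLeast A m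

  colexLeast : ∀ z → Numeral z → HasColexLeast z
  colexLeast = numeralInduction
    (allS (exW (v0 ∈' s0) ⇒' allW ((v0 ∈' s0) ⇒' fLen v0 v1 s1 s2)
           ⇒' exW ((v0 ∈' s0) ∧' allW ((v0 ∈' s0) ⇒' (v1 ≐ v0 ∨' fColex v1 v0)))))
    noWords withLengths base step
    where
    zeroFirst : ∀ {u} → Letter u → 𝟎 ≡ u ⊎ Colex 𝟎 u
    zeroFirst (inj₁ e) = inj₁ (sym e)
    zeroFirst (inj₂ e) = inj₂ (inj₁ (refl , e))
    base : HasColexLeast 𝟎
    base A (w , wA) lenA with em {𝟎 ∈ A}
    ... | yes 𝟎∈A = 𝟎 , 𝟎∈A , λ u uA → zeroFirst (len-𝟎⁻ (lenA u uA))
    ... | no 𝟎∉A = w , wA , λ u uA → inj₁ (trans (isOne w wA) (sym (isOne u uA)))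
      where
      isOne : ∀ u → u ∈ A → u ≡ 𝟏
      isOne u uA with len-𝟎⁻ (lenA u uA)
      ... | inj₁ refl = ⊥-elim (𝟎∉A uA)
      ... | inj₂ e = e
    -- the least word ends in 𝟎 if some word of A does, and in 𝟏 otherwise
    viaLast : ∀ x → HasColexLeast x → (A : System) → (∀ u → u ∈ A → Len u (x · 𝟎)) → ∀ a → Letter a → ∃[ u ] (u · a) ∈ A
      → (∀ u → (u · 𝟎) ∈ A → a ≡ 𝟎) → ∃[ m ] ColexLeast A m
    viaLast x ih A lenA a la (u₀ , u₀A) smallest with preimage A a
    ... | (B , eB) with ih B (u₀ , from (eB u₀) u₀A) (λ u uB → len-drop la (lenA _ (to (eB u) uB)))
    ...   | (m , leastB) = m · a , extendLeast A B la eB lenA smallest leastB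
    endsIn𝟏 : ∀ {x w} (A : System) → (∀ u → u ∈ A → Len u (x · 𝟎)) → w ∈ A
            → ¬ (∃[ u ] (u · 𝟎) ∈ A) → ∃[ u ] (u · 𝟏) ∈ A
    endsIn𝟏 {w = w} A lenA wA none with len-suc⁻ (lenA w wA)
    ... | (w' , _ , inj₁ refl , refl , _) = ⊥-elim (none (w' , wA))
    ... | (w' , _ , inj₂ refl , refl , _) = w' , wA
    step : ∀ x → Numeral x → HasColexLeast x → HasColexLeast (x · 𝟎)
    step x _ ih A (w , wA) lenA with em {∃[ u ] (u · 𝟎) ∈ A}
    ... | yes ends𝟎 = viaLast x ih A lenA 𝟎 letter𝟎 ends𝟎 (λ _ _ → refl)
    ... | no none = viaLast x ih A lenA 𝟏 letter𝟏 (endsIn𝟏 A lenA wA none) (λ u uA → ⊥-elim (none (u , uA)))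

  PrecLeast : System → Word → Set
  PrecLeast W m = m ∈ W × (∀ u → u ∈ W → m ≡ u ⊎ Prec m u)

  shortestColexLeast : ∀ {W m zs} → m ∈ W → Len m zs → (∀ u z → u ∈ W → Len u z → zs ⊑ z)
    → (∀ u → u ∈ W → Len u zs → m ≡ u ⊎ Colex m u) → PrecLeast W m
  shortestColexLeast {W} {m} {zs} mW mL shortest colexMin = mW , compare
    where
    compare : ∀ u → u ∈ W → m ≡ u ⊎ Prec m u
    compare u uW with len-total u
    ... | (zu , hu) with shortest u zu uW hu
    ...   | inj₂ lt = inj₂ (inj₁ (zs , zu , mL , hu , lt))
    ...   | inj₁ refl with colexMin u uW hu
    ...     | inj₁ e = inj₁ e
    ...     | inj₂ c = inj₂ (inj₂ (zs , mL , hu , c))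

  precLeast : (W : System) → ∃[ w ] w ∈ W → ∃[ m ] PrecLeast W m
  precLeast W (w , wW) with lengthsOf W | len-total w
  ... | (Λ , eΛ) | (zw , hw) with leastNumeral Λ (zw , fromNumerals (proj₁ hw) , from (eΛ zw) (w , wW , hw))
  ...   | (zs , zsN , zsΛ , zsLeast) with ofLength W zs | to (eΛ zs) zsΛ
  ...     | (B , eB) | (u₀ , u₀W , u₀L) with colexLeast zs zsN B (u₀ , from (eB u₀) (u₀W , u₀L)) (λ u uB → proj₂ (to (eB u) uB))
  ...       | (m , mB , mLeast) =
    m , shortestColexLeast (proj₁ (to (eB m) mB)) (proj₂ (to (eB m) mB))
          (λ u z uW hu → zsLeast z (fromNumerals (proj₁ hu)) (from (eΛ z) (u , uW , hu)))
          (λ u uW hu → mLeast u (from (eB u) (uW , hu)))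

  -- A system bounded above in the shortlex order admits no endless ascent:
  -- it would have a greatest length, and its words of that length would
  -- ascend colexicographically forever.
  precNoAscent : (C : System) (w : Word) → (∀ c → c ∈ C → Prec c w)
    → (∀ c → c ∈ C → ∃[ c' ] c' ∈ C × Prec c c') → ∀ c → ¬ (c ∈ C)
  precNoAscent C w bounded ascent c cC with lengthsOf C | len-total w | len-total c
  ... | (Λ , eΛ) | (b , hb) | (zc , hc) with greatestBelow b (fromNumerals (proj₁ hb)) Λ (zc , from (eΛ zc) (c , cC , hc)) boundΛ
    where
    boundΛ : ∀ z → z ∈ Λ → z ⊑ b
    boundΛ z zΛ with to (eΛ z) zΛ
    ... | (c' , c'C , h) = prec-len (bounded c' c'C) h hb
  ...   | (zs , zsΛ , zsMax) with ofLength C zs | to (eΛ zs) zsΛ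
  ...     | (Cs , eCs) | (c₀ , c₀C , c₀L) =
    colex-noAscent zs (fromNumerals (proj₁ c₀L)) Cs (λ u uCs → proj₂ (to (eCs u) uCs)) ascentCs c₀ (from (eCs c₀) (c₀C , c₀L))
    where
    ascentCs : ∀ u → u ∈ Cs → ∃[ v ] v ∈ Cs × Colex u v
    ascentCs u uCs with to (eCs u) uCs
    ... | (uC , hu) with ascent u uC
    ...   | (c' , c'C , inj₁ (z₁ , z₂ , h₁ , h₂ , lt)) rewrite len-functional hu h₁ with zsMax z₂ (from (eΛ z₂) (c' , c'C , h₂))
    ...     | inj₁ refl = ⊥-elim (⊏-irrefl lt)
    ...     | inj₂ lt' = ⊥-elim (⊏-irrefl (⊏-trans lt lt'))
    ascentCs u uCs | (uC , hu) | (c' , c'C , inj₂ (z' , h₁ , h₂ , col)) rewrite len-functional hu h₁ =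
      c' , from (eCs c') (c'C , h₂) , col

-- Starting
-- from [a, b], repeatedly replace the current interval (l, r), l < r, by
-- (m₁, m₂), where m₁ is the shortlex-least element strictly between l and
-- r, and m₂ the shortlex-least one strictly between m₁ and r.  Intervals
-- are represented by the elements of (t)_T coding the pairs (l, r), so the
-- chain of intervals is a definable system.  If p were a least upper bound
-- of the set D of left endpoints, p would lie strictly inside every
-- interval; then every chosen m₁ is shortlex-below p, and each m₁ is
-- shortlex-below the next one: an endless ascent bounded by p, which is
-- impossible since the shortlex order has type ω.

-- Positions, inside a formula, of the fixed parameters: the words e₀, x, t
-- and the systems X, T, LengthCodes, Numerals.
record Params (n m : ℕ) : Set where
  constructor params
  field
    e₀' x' t' : Term n
    iX iT iL iZ : Fin m
open Params

wkP : ∀ {n m} → Params n m → Params (suc n) m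
wkP (params e x t i j k l) = params (wkT e) (wkT x) (wkT t) i j k l

wkPs : ∀ k {n m} → Params n m → Params (k + n) m
wkPs zero π = π
wkPs (suc k) π = wkP (wkPs k π)

wkPS : ∀ {n m} → Params n m → Params n (suc m)
wkPS (params e x t i j k l) = params e x t (suc i) (suc j) (suc k) (suc l)

module NestedIntervals (M : Model) (em : ExcludedMiddle 0ℓ) (F : Notions.SetFoundation M)
                       (x : Model.Word M) (X : Model.System M) (t : Model.Word M) (T : Model.System M) where
  open Model M
  open Equivalence
  open Notions M
  open OverFoundation F
  open SetFoundation F
  open Order x X t T
  open Words M
  open WellOrdering M em

  -- The order notions of Defs in definable form: `⇔` becomes a pair of
  -- implications, as produced by the satisfaction relation.
  Pair : Word → Word → Word → Set
  Pair c l r = ∀ y → (Elem y c T → y ≡ l ⊎ y ≡ l · r) × (y ≡ l ⊎ y ≡ l · r → Elem y c T)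

  -- c is the element of (t)_T coding the pair (l, r), i.e. witnessing l ≤ r.
  Code : Word → Word → Word → Set
  Code c l r = Elem c t T × Pair c l r

  _≼_ : Word → Word → Set
  a ≼ b = ∃[ c ] Code c a b

  _≺_ : Word → Word → Set
  a ≺ b = a ≼ b × a ≢ b

  Between : Word → Word → Word → Set
  Between w l r = Elem w x X × l ≺ w × w ≺ r

  LeastBetween : Word → Word → Word → Set
  LeastBetween m l r = Between m l r × (∀ u → Between u l r → m ≡ u ⊎ Prec m u)

  Step : Word → Word → Set
  Step c c' = ∃[ l ] ∃[ r ] ∃[ m₁ ] ∃[ m₂ ] Code c l r × Code c' m₁ m₂ × LeastBetween m₁ l r × LeastBetween m₂ m₁ r

  Chain : Word → Word → Set
  Chain b w = (S : System) → b ∈ S → ((c c' : Word) → c ∈ S → Step c c' → c' ∈ S) → w ∈ S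

  fElem : ∀ {n m} → Params n m → Term n → Term n → Fin m → Formula n m
  fElem π y e i = ((y ⊙ e₀' π) ⊙ e) ∈' i

  fPair : ∀ {n m} → Params n m → Term n → Term n → Term n → Formula n m
  fPair π c l r = allW ((fElem (wkP π) v0 (wkT c) (iT π) ⇒' (v0 ≐ wkT l ∨' v0 ≐ wkT l ⊙ wkT r))
                     ∧' ((v0 ≐ wkT l ∨' v0 ≐ wkT l ⊙ wkT r) ⇒' fElem (wkP π) v0 (wkT c) (iT π)))

  fCode : ∀ {n m} → Params n m → Term n → Term n → Term n → Formula n m
  fCode π c l r = fElem π c (t' π) (iT π) ∧' fPair π c l r

  f≼ : ∀ {n m} → Params n m → Term n → Term n → Formula n m
  f≼ π a b = exW (fCode (wkP π) v0 (wkT a) (wkT b))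

  f≺ : ∀ {n m} → Params n m → Term n → Term n → Formula n m
  f≺ π a b = f≼ π a b ∧' ¬' (a ≐ b)

  fBetween : ∀ {n m} → Params n m → Term n → Term n → Term n → Formula n m
  fBetween π w l r = fElem π w (x' π) (iX π) ∧' f≺ π l w ∧' f≺ π w r

  fLeastBetween : ∀ {n m} → Params n m → Term n → Term n → Term n → Formula n m
  fLeastBetween π m l r =
    fBetween π m l r ∧' allW (fBetween (wkP π) v0 (wkT l) (wkT r) ⇒' (wkT m ≐ v0 ∨' fPrec (wkT m) v0 (iL π) (iZ π)))

  fStep : ∀ {n m} → Params n m → Term n → Term n → Formula n m
  fStep {n} {m} π c c' = exW (exW (exW (exW (
    fCode π₄ (wk₄ c) v3 v2 ∧' fCode π₄ (wk₄ c') v1 v0 ∧' fLeastBetween π₄ v1 v3 v2 ∧' fLeastBetween π₄ v0 v1 v2))))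
    where
    π₄ : Params (4 + n) m
    π₄ = wkPs 4 π
    wk₄ : Term n → Term (4 + n)
    wk₄ s = wkT (wkT (wkT (wkT s)))

  fChain : ∀ {n m} → Params n m → Term n → Term n → Formula n m
  fChain π b w = allS ((b ∈' s0) ⇒' allW (allW ((v1 ∈' s0) ⇒' fStep (wkP (wkP (wkPS π))) v1 v0 ⇒' (v0 ∈' s0))) ⇒' (w ∈' s0))

  π₀ : Params 3 4
  π₀ = params v0 v1 v2 s0 s1 s2 s3

  ρ₀ : Fin 3 → Word
  ρ₀ = extend e₀ (extend x (extend t noWords))

  σ₀ : Fin 4 → System
  σ₀ = extend X (extend T withLengths)

  pair-determined : ∀ {c l r l' r'} → Pair c l r → Pair c l' r' → l ≡ l' × r ≡ r'
  pair-determined {c} {l} {r} {l'} {r'} P P'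
    with proj₁ (P' l) (proj₂ (P l) (inj₁ refl)) | proj₁ (P l') (proj₂ (P' l') (inj₁ refl))
       | proj₁ (P' (l · r)) (proj₂ (P (l · r)) (inj₂ refl))
  ... | inj₁ refl | _ | inj₁ e = ⊥-elim (x·y≢x l r e)
  ... | inj₁ refl | _ | inj₂ e = refl , ·-cancelˡ e
  ... | inj₂ refl | inj₁ e | _ = ⊥-elim (x·y≢x l' r' (sym e))
  ... | inj₂ refl | inj₂ e | _ = ⊥-elim (x·y≢x l' (r' · r) (trans (sym (assoc l' r' r)) (sym e)))

  toPair : ∀ {c l r} → Assoc c T l r → Pair c l r
  toPair A y = to (A y) , from (A y)

  fromPair : ∀ {c l r} → Pair c l r → Assoc c T l r
  fromPair P y = mk⇔ (proj₁ (P y)) (proj₂ (P y))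

  ≼-from≤ : ∀ {a b} → a ≤o b → a ≼ b
  ≼-from≤ (c , e , A) = c , e , toPair A

  ≼-to≤ : ∀ {a b} → a ≼ b → a ≤o b
  ≼-to≤ (c , e , P) = c , e , fromPair P

  recode : ∀ {c l r l' r'} (Q : Word → Word → Set) → Code c l r → Code c l' r' → Q l r → Q l' r'
  recode {l = l} {r} {l'} {r'} Q (_ , P) (_ , P') q = subst₂ Q (proj₁ e) (proj₂ e) q
    where
    e : l ≡ l' × r ≡ r'
    e = pair-determined P P'

  module Construction (total : IsTotalOrder) (dense : IsDense) where

    code-elems : ∀ {c l r} → Code c l r → Elem l x X × Elem r x X
    code-elems {c} (ec , P) =
      let (_ , _ , ea , eb , A) = proj₁ (proj₁ (proj₁ total)) c ec
      in recode (λ l r → Elem l x X × Elem r x X) (ec , toPair A) (ec , P) (ea , eb)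

    ≼-elems : ∀ {a b} → a ≼ b → Elem a x X × Elem b x X
    ≼-elems (_ , code) = code-elems code

    ≼-refl : ∀ {a} → Elem a x X → a ≼ a
    ≼-refl ea = ≼-from≤ (proj₁ (proj₂ (proj₁ total)) _ ea)

    ≼-trans : ∀ {a b c} → a ≼ b → b ≼ c → a ≼ c
    ≼-trans p q = ≼-from≤ (proj₂ (proj₂ (proj₂ (proj₁ total))) _ _ _
      (proj₁ (≼-elems p)) (proj₂ (≼-elems p)) (proj₂ (≼-elems q)) (≼-to≤ p) (≼-to≤ q))

    ≼-antisym : ∀ {a b} → a ≼ b → b ≼ a → a ≡ b
    ≼-antisym p q = proj₁ (proj₂ (proj₂ (proj₁ total))) _ _ (proj₁ (≼-elems p)) (proj₂ (≼-elems p)) (≼-to≤ p) (≼-to≤ q)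

    ≼-≺-trans : ∀ {a b c} → a ≼ b → b ≺ c → a ≺ c
    ≼-≺-trans p (q , b≢c) = ≼-trans p q , λ { refl → b≢c (≼-antisym q p) }

    ≺-≼-trans : ∀ {a b c} → a ≺ b → b ≼ c → a ≺ c
    ≺-≼-trans (p , a≢b) q = ≼-trans p q , λ { refl → a≢b (≼-antisym p q) }

    ≺-trans : ∀ {a b c} → a ≺ b → b ≺ c → a ≺ c
    ≺-trans p q = ≺-≼-trans p (proj₁ q)

    -- Least elements of intervals: by density the open interval (l, r) is
    -- nonempty, so it has a shortlex-least element, which is unique.

    betweenSystem : ∀ l r → Σ System λ B → ∀ w → (w ∈ B) ⇔ Between w l r
    betweenSystem l r = comprehension (fBetween (wkPs 3 π₀) v0 v1 v2) (extend l (extend r ρ₀)) σ₀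

    between-nonempty : ∀ {l r} → l ≺ r → ∃[ w ] Between w l r
    between-nonempty (l≼r , l≢r) with ≼-elems l≼r
    ... | (el , er) with dense _ _ el er (≼-to≤ l≼r , l≢r)
    ...   | (w , ew , (p , l≢w) , (q , w≢r)) = w , ew , (≼-from≤ p , l≢w) , (≼-from≤ q , w≢r)

    leastBetween : ∀ {l r} → l ≺ r → ∃[ m ] LeastBetween m l r
    leastBetween {l} {r} l≺r = m , to (eB m) mB , λ u hu → least u (from (eB u) hu)
      where
      B : System
      B = proj₁ (betweenSystem l r)
      eB : ∀ w → (w ∈ B) ⇔ Between w l r
      eB = proj₂ (betweenSystem l r)
      nonempty : ∃[ w ] w ∈ B
      nonempty = let (w , hw) = between-nonempty l≺r in w , from (eB w) hw
      m : Word
      m = proj₁ (precLeast B nonempty)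
      mB : m ∈ B
      mB = proj₁ (proj₂ (precLeast B nonempty))
      least : ∀ u → u ∈ B → m ≡ u ⊎ Prec m u
      least = proj₂ (proj₂ (precLeast B nonempty))

    above : ∀ {m l r} → LeastBetween m l r → l ≺ m
    above L = proj₁ (proj₂ (proj₁ L))

    below : ∀ {m l r} → LeastBetween m l r → m ≺ r
    below L = proj₂ (proj₂ (proj₁ L))

    leastBetween-unique : ∀ {m m' l r} → LeastBetween m l r → LeastBetween m' l r → m ≡ m'
    leastBetween-unique (h , least) (h' , least') with least _ h' | least' _ h
    ... | inj₁ e | _ = e
    ... | inj₂ _ | inj₁ e = sym e
    ... | inj₂ p | inj₂ q = ⊥-elim (prec-asym p q)

    step-exists : ∀ {c l r} → Code c l r → l ≺ r → ∃[ c' ] Step c c'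
    step-exists {c} {l} {r} code l≺r =
      let (m₁ , L₁) = leastBetween l≺r
          (m₂ , L₂) = leastBetween (below L₁)
          (c' , code') = proj₁ (above L₂)
      in c' , l , r , m₁ , m₂ , code , code' , L₁ , L₂

    step-codes : ∀ {c c' l r m₁ m₂} → Step c c' → Code c l r → Code c' m₁ m₂
               → LeastBetween m₁ l r × LeastBetween m₂ m₁ r
    step-codes {l = l} {r} (_ , _ , n₁ , n₂ , code , code' , L₁ , L₂) codeC codeC' =
      recode (λ m₁ m₂ → LeastBetween m₁ l r × LeastBetween m₂ m₁ r) code' codeC'
        (recode (λ l r → LeastBetween n₁ l r × LeastBetween n₂ n₁ r) code codeC (L₁ , L₂))

    step-deterministic : ∀ {c c₁ c₂} → Step c c₁ → Step c c₂ → c₁ ≡ c₂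
    step-deterministic {c} {c₁} {c₂} st₁@(l , r , m₁ , m₂ , code , code₁ , L₁ , L₂) st₂@(_ , _ , n₁ , n₂ , _ , code₂ , _) =
      proj₂ (proj₁ (proj₁ total)) c₁ c₂ m₁ m₂ (proj₁ code₁) (proj₁ code₂)
        (fromPair (proj₂ code₁)) (fromPair (proj₂ code₂'))
      where
      L' : LeastBetween n₁ l r × LeastBetween n₂ n₁ r
      L' = step-codes st₂ code code₂
      m₁≡n₁ : m₁ ≡ n₁
      m₁≡n₁ = leastBetween-unique L₁ (proj₁ L')
      m₂≡n₂ : m₂ ≡ n₂
      m₂≡n₂ = leastBetween-unique L₂ (subst (λ a → LeastBetween n₂ a r) (sym m₁≡n₁) (proj₂ L'))
      code₂' : Code c₂ m₁ m₂
      code₂' = subst₂ (Code c₂) (sym m₁≡n₁) (sym m₂≡n₂) code₂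

    chain-refl : ∀ {b} → Chain b b
    chain-refl S bS _ = bS

    chain-snoc : ∀ {b c c'} → Chain b c → Step c c' → Chain b c'
    chain-snoc {c = c} {c'} h st S bS closed = closed c c' (h S bS closed) st

    chainInduction : ∀ {n m} (φ : Formula (suc n) m) (ρ : Fin n → Word) (σ : Fin m → System) (b : Word)
      → sat (extend b ρ) σ φ → (∀ c c' → sat (extend c ρ) σ φ → Step c c' → sat (extend c' ρ) σ φ)
      → ∀ w → Chain b w → sat (extend w ρ) σ φ
    chainInduction φ ρ σ b hb hs w hw = to (eq w) (hw S (from (eq b) hb) (λ c c' cS st → from (eq c') (hs c c' (to (eq c) cS) st)))
      where
      S : System
      S = proj₁ (comprehension φ ρ σ)
      eq : ∀ w → (w ∈ S) ⇔ sat (extend w ρ) σ φ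
      eq = proj₂ (comprehension φ ρ σ)

    chain-first : ∀ {b w} → Chain b w → w ≡ b ⊎ ∃[ c' ] Step b c' × Chain c' w
    chain-first {b} {w} = chainInduction (v0 ≐ v1 ∨' exW (fStep (wkPs 3 π₀) v2 v0 ∧' fChain (wkPs 3 π₀) v0 v1))
                            (extend b ρ₀) σ₀ b (inj₁ refl) grow w
      where
      grow : ∀ c c' → (c ≡ b ⊎ ∃[ d ] Step b d × Chain d c) → Step c c' → c' ≡ b ⊎ ∃[ d ] Step b d × Chain d c'
      grow c c' (inj₁ refl) st = inj₂ (c' , st , chain-refl)
      grow c c' (inj₂ (d , st' , ch)) st = inj₂ (d , st' , chain-snoc ch st)

    chain-last : ∀ {b w} → Chain b w → w ≡ b ⊎ ∃[ c ] Step c w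
    chain-last {b} {w} = chainInduction (v0 ≐ v1 ∨' exW (fStep (wkPs 3 π₀) v0 v1)) (extend b ρ₀) σ₀ b (inj₁ refl)
                           (λ c c' _ st → inj₂ (c , st)) w

    -- Since steps are deterministic, the chain is linearly ordered.
    chain-linear : ∀ {c₀ c₁ c₂} → Chain c₀ c₁ → Chain c₀ c₂ → Chain c₁ c₂ ⊎ Chain c₂ c₁
    chain-linear {c₀} {c₁} {c₂} h₁ = linear c₁ h₁ c₂
      where
      afterStep : ∀ {c c' c₂} → Step c c' → c₂ ≡ c ⊎ ∃[ d ] Step c d × Chain d c₂ → Chain c' c₂ ⊎ Chain c₂ c'
      afterStep st (inj₁ refl) = inj₂ (chain-snoc chain-refl st)
      afterStep st (inj₂ (d , st' , ch)) = inj₁ (subst (λ y → Chain y _) (sym (step-deterministic st st')) ch)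
      advance : ∀ {c c' c₂} → Step c c' → Chain c c₂ ⊎ Chain c₂ c → Chain c' c₂ ⊎ Chain c₂ c'
      advance st (inj₁ ch) = afterStep st (chain-first ch)
      advance st (inj₂ ch) = inj₂ (chain-snoc ch st)
      linear : ∀ c₁ → Chain c₀ c₁ → ∀ c₂ → Chain c₀ c₂ → Chain c₁ c₂ ⊎ Chain c₂ c₁
      linear = chainInduction (allW (fChain (wkPs 3 π₀) v2 v0 ⇒' (fChain (wkPs 3 π₀) v1 v0 ∨' fChain (wkPs 3 π₀) v0 v1)))
                 (extend c₀ ρ₀) σ₀ c₀ (λ c₂ h → inj₁ h) (λ c c' ih st c₂ h → advance st (ih c₂ h))

    chain-nested : ∀ {c l r w l' r'} → Code c l r → Chain c w → Code w l' r' → l ≼ l' × r' ≼ r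
    chain-nested {c} {l} {r} {w} {l'} {r'} code ch code' = nested w ch l' r' code'
      where
      base : ∀ l' r' → Code c l' r' → l ≼ l' × r' ≼ r
      base l' r' code' = recode (λ l' r' → l ≼ l' × r' ≼ r) code code'
                           (≼-refl (proj₁ (code-elems code)) , ≼-refl (proj₂ (code-elems code)))
      step : ∀ c₁ c₂ → (∀ l' r' → Code c₁ l' r' → l ≼ l' × r' ≼ r) → Step c₁ c₂
           → ∀ l'' r'' → Code c₂ l'' r'' → l ≼ l'' × r'' ≼ r
      step c₁ c₂ ih st@(l₁ , r₁ , _ , _ , code₁ , _) l'' r'' code'' =
        let (L₁ , L₂) = step-codes st code₁ code'' ; (l≼l₁ , r₁≼r) = ih l₁ r₁ code₁
        in ≼-trans l≼l₁ (proj₁ (above L₁)) , ≼-trans (proj₁ (below L₂)) r₁≼r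
      nested : ∀ w → Chain c w → ∀ l' r' → Code w l' r' → l ≼ l' × r' ≼ r
      nested = chainInduction (allW (allW (fCode (wkPs 5 π₀) v2 v1 v0 ⇒' (f≼ (wkPs 5 π₀) v3 v1 ∧' f≼ (wkPs 5 π₀) v0 v4))))
                 (extend l (extend r ρ₀)) σ₀ c base step

    -- Along two consecutive steps c → c' → c'', the second chosen word lies
    -- strictly inside the interval of c and differs from the first one, the
    -- least such word; so it is shortlex-larger.
    chosen-increase : ∀ {c c' c'' m r m' r'} → Step c c' → Step c' c'' → Code c' m r → Code c'' m' r' → Prec m m'
    chosen-increase {m = m} {r} {m'} st@(l , r₀ , _ , _ , code , _) st' code' code'' = larger (proj₂ L₁ m' inside)
      where
      L₁ : LeastBetween m l r₀
      L₁ = proj₁ (step-codes st code code')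
      L₂ : LeastBetween r m r₀
      L₂ = proj₂ (step-codes st code code')
      L₁' : LeastBetween m' m r
      L₁' = proj₁ (step-codes st' code' code'')
      inside : Between m' l r₀
      inside = proj₁ (proj₁ L₁') , ≺-trans (above L₁) (above L₁') , ≺-trans (below L₁') (below L₂)
      larger : m ≡ m' ⊎ Prec m m' → Prec m m'
      larger (inj₁ e) = ⊥-elim (proj₂ (above L₁') e)
      larger (inj₂ q) = q

    module FromInterval {c₀ a b : Word} (code₀ : Code c₀ a b) (a≺b : a ≺ b) where

      proper : ∀ {c l r} → Chain c₀ c → Code c l r → l ≺ r
      proper ch code = fromLast (chain-last ch) code
        where
        fromLast : ∀ {c l r} → c ≡ c₀ ⊎ ∃[ p ] Step p c → Code c l r → l ≺ r
        fromLast (inj₁ refl) code = recode _≺_ code₀ code a≺b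
        fromLast (inj₂ (p , st@(_ , _ , _ , _ , codeP , _))) code = above (proj₂ (step-codes st codeP code))

      LeftEnd : Word → Set
      LeftEnd y = ∃[ c ] ∃[ r ] Chain c₀ c × Code c y r

      leftEnds : (d : Word) → Σ System λ D → ∀ z → (z ∈ D) ⇔ (∃[ y ] z ≡ (y · e₀) · d × LeftEnd y)
      leftEnds d = comprehension
        (exW (v1 ≐ (v0 ⊙ v4) ⊙ v2 ∧' exW (exW (fChain (wkPs 6 π₀) v5 v1 ∧' fCode (wkPs 6 π₀) v1 v2 v0))))
        (extend d (extend c₀ ρ₀)) σ₀

      Chosen : Word → Set
      Chosen m = ∃[ c ] ∃[ c' ] ∃[ r ] Chain c₀ c × Step c c' × Code c' m r

      chosenSystem : Σ System λ C → ∀ m → (m ∈ C) ⇔ Chosen m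
      chosenSystem = comprehension
        (exW (exW (exW (fChain (wkPs 5 π₀) v4 v2 ∧' fStep (wkPs 5 π₀) v2 v1 ∧' fCode (wkPs 5 π₀) v1 v3 v0))))
        (extend c₀ ρ₀) σ₀

      first-chosen : ∃[ m ] Chosen m
      first-chosen =
        let (c₁ , st) = step-exists code₀ a≺b
            (_ , _ , m₁ , m₂ , _ , code₁ , _) = st
        in m₁ , c₀ , c₁ , m₂ , chain-refl , st , code₁

      chosen-ascent : ∀ {m} → Chosen m → ∃[ m' ] Chosen m' × Prec m m'
      chosen-ascent (c , c' , r , ch , st , code') =
        let (c'' , st') = step-exists code' (proper (chain-snoc ch st) code')
            (_ , _ , m' , r' , _ , code'' , _) = st'
        in m' , (c' , c'' , r' , chain-snoc ch st , st' , code'') , chosen-increase st st' code' code''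

      module LeftEndSet (d : Word) where

        D : System
        D = proj₁ (leftEnds d)

        elem⇒leftEnd : ∀ {y} → Elem y d D → LeftEnd y
        elem⇒leftEnd {y} h =
          let (y' , e , left) = to (proj₂ (leftEnds d) ((y · e₀) · d)) h
          in subst LeftEnd (sym (simplif y e₀ y' e₀ (simplif (y · e₀) d (y' · e₀) d e refl) refl)) left

        leftEnd⇒elem : ∀ {y} → LeftEnd y → Elem y d D
        leftEnd⇒elem {y} left = from (proj₂ (leftEnds d) ((y · e₀) · d)) (y , refl , left)

        subset : Subset d D x X
        subset y ey = let (_ , _ , _ , code) = elem⇒leftEnd ey in proj₁ (code-elems code)

        -- Right endpoints of intervals of the chain are upper bounds of D,
        -- since the chain is linear and its intervals are nested.
        rightEnd-bound : ∀ {c m₁ m₂} → Chain c₀ c → Code c m₁ m₂ → ∀ y → Elem y d D → y ≼ m₂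
        rightEnd-bound {c} {m₁} {m₂} ch code y ey =
          let (_ , _ , ch₂ , code₂) = elem⇒leftEnd ey in compare ch₂ code₂ (chain-linear ch ch₂)
          where
          compare : ∀ {c₂ r₂} → Chain c₀ c₂ → Code c₂ y r₂ → Chain c c₂ ⊎ Chain c₂ c → y ≼ m₂
          compare ch₂ code₂ (inj₁ later) = ≼-trans (proj₁ (proper ch₂ code₂)) (proj₂ (chain-nested code later code₂))
          compare ch₂ code₂ (inj₂ earlier) = ≼-trans (proj₁ (chain-nested code₂ earlier code)) (proj₁ (proper ch code))

        module _ {p : Word} (lub : LeastUpperBound d D p) where

          -- p lies strictly inside every interval of the chain: it is above
          -- the left and below the right endpoint of the refined interval.
          inside : ∀ {c l r} → Chain c₀ c → Code c l r → l ≺ p × p ≺ r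
          inside ch code =
            let (c' , st) = step-exists code (proper ch code)
                (_ , _ , m₁ , m₂ , _ , code' , _) = st
                (L₁ , L₂) = step-codes st code code'
                m₁≼p = ≼-from≤ (proj₂ (proj₁ lub) m₁ (leftEnd⇒elem (c' , m₂ , chain-snoc ch st , code')))
                p≼m₂ = ≼-from≤ (proj₂ lub m₂ (proj₂ (code-elems code') ,
                                             λ y ey → ≼-to≤ (rightEnd-bound (chain-snoc ch st) code' y ey)))
            in ≺-≼-trans (above L₁) m₁≼p , ≼-≺-trans p≼m₂ (below L₂)

          chosen-below : ∀ {m} → Chosen m → Prec m p
          chosen-below {m} (c , c' , r' , ch , st@(_ , _ , _ , _ , code , _) , code') =
            notP (proj₂ (proj₁ (step-codes st code code')) p (proj₁ (proj₁ lub) , inside ch code))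
            where
            notP : m ≡ p ⊎ Prec m p → Prec m p
            notP (inj₁ e) = ⊥-elim (proj₂ (proj₁ (inside (chain-snoc ch st) code')) e)
            notP (inj₂ q) = q

          absurd : ⊥
          absurd = precNoAscent C p (λ m mC → chosen-below (to (eC m) mC)) ascent
                     (proj₁ first-chosen) (from (eC _) (proj₂ first-chosen))
            where
            C : System
            C = proj₁ chosenSystem
            eC : ∀ m → (m ∈ C) ⇔ Chosen m
            eC = proj₂ chosenSystem
            ascent : ∀ m → m ∈ C → ∃[ m' ] m' ∈ C × Prec m m'
            ascent m mC = let (m' , chosen , q) = chosen-ascent (to (eC m) mC) in m' , from (eC m') chosen , q

    -- A proper interval yields, through its chain, a set without least upper
    -- bound; a letter of S₀ serves as the representation of that set.
    fromInterval : ∀ {a b} → a ≺ b → ∃[ d ] ∃[ D ] IsSet d D × Subset d D x X × ¬ (∃[ y ] LeastUpperBound d D y)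
    fromInterval a≺b =
      let (d , d∈S₀) = proj₁ (proj₂ S₀-expressive)
          open FromInterval (proj₂ (proj₁ a≺b)) a≺b
          open LeftEndSet d
      in d , D , (λ S letters _ → letters d d∈S₀) , subset , λ (p , lub) → absurd lub

    noCompleteness : ∀ {a₁ a₂} → Elem a₁ x X → Elem a₂ x X → a₁ ≢ a₂
      → ∃[ d ] ∃[ D ] IsSet d D × Subset d D x X × ¬ (∃[ y ] LeastUpperBound d D y)
    noCompleteness {a₁} {a₂} e₁ e₂ a₁≢a₂ = orient (proj₂ total a₁ a₂ e₁ e₂)
      where
      orient : a₁ ≤o a₂ ⊎ a₂ ≤o a₁ → ∃[ d ] ∃[ D ] IsSet d D × Subset d D x X × ¬ (∃[ y ] LeastUpperBound d D y)
      orient (inj₁ a₁≤a₂) = fromInterval (≼-from≤ a₁≤a₂ , a₁≢a₂)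
      orient (inj₂ a₂≤a₁) = fromInterval (≼-from≤ a₂≤a₁ , λ e → a₁≢a₂ (sym e))

mainTheorem6 : Theorem6
mainTheorem6 M em F x X t T _ _ total dense (a₁ , a₂ , e₁ , e₂ , a₁≢a₂) =
  NestedIntervals.Construction.noCompleteness M em F x X t T total dense e₁ e₂ a₁≢a₂
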